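{- For all $n\ge1$, \[ \Psi_{C_n}(t) + t^n\,\Psi_{C_n}(t^{ -1}) = E_{B_n}(t). \]
   Context: $\mathfrak{B}_n$ is the group of bijections $w$ of $[\![n]\!] := \{ -n,\dots,-1,1,\dots,n\}$ with $w(-i)=-w(i)$; $\bar i := -i$, $w_i := w(i)$. $X_n := \{w \in \mathfrak{B}_n \mid w^{ -1}(1) > 0\}$. $\operatorname{des}_B(w)$ is the number of $i\in\{0,\dots,n-1\}$ with $w_i>w_{i+1}$, where $w_0:=0$; $E_{B_n}(t) := \sum_{w\in\mathfrak{B}_n} t^{\operatorname{des}_B(w)}$ is the type B Eulerian polynomial. Order $[\![n]\!]$ by $\bar n < \dots < \bar 1 < 1 < \dots < n$; write $a \ll b$ if some $c \in [\![n]\!]$ satisfies $a<c<b$. $w$ has a big ascent at $\bar1$ iff $w_1 \ge 2$; at $i\in\{1,\dots,n-1\}$ iff $w_i \ll w_{i+1}$; at $n$ iff $w_n \le \bar 2$; $\operatorname{basc}(w)$ is the number of big ascents. $\Psi_{C_n}(t) := \sum_{w\in X_n} t^{\operatorname{basc}(w)}$. -}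

module Defs where

open import Data.Nat using (ℕ; zero; suc) renaming (_+_ to _+ℕ_)
open import Data.Integer using (ℤ; +_; -_; _<_; _≤_; _≟_; _<?_; _≤?_)
open import Data.Bool using (Bool; true; false; _∧_; if_then_else_)
open import Data.List using (List; []; _∷_; map; _++_; reverse; upTo; concatMap; length)
open import Data.Bool.ListAction using (all; any)
open import Relation.Nullary.Decidable using (⌊_⌋)

oneTo : ℕ → List ℕ
oneTo n = map suc (upTo n)

signed : ℕ → List ℤ
signed n = map (λ i → - (+ i)) (reverse (oneTo n)) ++ map +_ (oneTo n)

words : ℕ → ℕ → List (List ℤ)
words n zero = [] ∷ []
words n (suc k) = concatMap (λ x → map (x ∷_) (words n k)) (signed n)

absℕ : ℤ → ℕ
absℕ (+ m) = m
absℕ (Data.Integer.-[1+ m ]) = suc m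

-- A signed permutation w ∈ 𝔅ₙ is determined by its window w₁ … wₙ;
-- a word of length n over [[n]] is such a window iff every j ∈ {1..n}
-- occurs as some |wᵢ|.
isSignedPerm : ℕ → List ℤ → Bool
isSignedPerm n w = all (λ j → any (λ x → ⌊ absℕ x Data.Nat.≟ j ⌋) w) (oneTo n)

filterᵇ' : {A : Set} → (A → Bool) → List A → List A
filterᵇ' p [] = []
filterᵇ' p (x ∷ xs) = if p x then x ∷ filterᵇ' p xs else filterᵇ' p xs

B : ℕ → List (List ℤ)
B n = filterᵇ' (isSignedPerm n) (words n n)

-- w ∈ Xₙ  iff  w⁻¹(1) > 0  iff  wᵢ = 1 for some i ∈ {1..n}
inX : List ℤ → Bool
inX w = any (λ x → ⌊ x ≟ + 1 ⌋) w

b2n : Bool → ℕ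
b2n true = 1
b2n false = 0

countDesc : List ℤ → ℕ
countDesc [] = 0
countDesc (x ∷ []) = 0
countDesc (x ∷ y ∷ xs) = b2n ⌊ y <? x ⌋ +ℕ countDesc (y ∷ xs)

desB : List ℤ → ℕ
desB w = countDesc (+ 0 ∷ w)

ll : ℕ → ℤ → ℤ → Bool
ll n a b = any (λ c → ⌊ a <? c ⌋ ∧ ⌊ c <? b ⌋) (signed n)

countLL : ℕ → List ℤ → ℕ
countLL n [] = 0
countLL n (x ∷ []) = 0
countLL n (x ∷ y ∷ xs) = b2n (ll n x y) +ℕ countLL n (y ∷ xs)

bascStart : List ℤ → ℕ
bascStart [] = 0
bascStart (x ∷ _) = b2n ⌊ + 2 ≤? x ⌋

bascEnd : List ℤ → ℕ
bascEnd [] = 0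
bascEnd (x ∷ []) = b2n ⌊ x ≤? - (+ 2) ⌋
bascEnd (x ∷ y ∷ xs) = bascEnd (y ∷ xs)

basc : ℕ → List ℤ → ℕ
basc n w = bascStart w +ℕ countLL n w +ℕ bascEnd w

countᵇ : {A : Set} → (A → Bool) → List A → ℕ
countᵇ p xs = length (filterᵇ' p xs)

-- [t^k] Ψ_{C_n}(t), for k ∈ ℤ (Laurent coefficient)
coeffΨ : ℕ → ℤ → ℕ
coeffΨ n k = countᵇ (λ w → inX w ∧ ⌊ (+ basc n w) ≟ k ⌋) (B n)

-- [t^k] E_{B_n}(t), for k ∈ ℤ
coeffE : ℕ → ℤ → ℕ
coeffE n k = countᵇ (λ w → ⌊ (+ desB w) ≟ k ⌋) (B n)

-- Two facts combine. First, basc and desB are equidistributed on Xₙ: inserting the letter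
-- ±(n+1) into a window w of 𝔅ₙ in each of its 2(n+1) positions, exactly 2s+1 of the new
-- windows keep the value s of the statistic and the others get s+1, for both statistics,
-- so by induction on n, Ψ_{C_n}(t) = Σ_{w ∈ Xₙ} t^{des_B w}. Second, w ↦ -w swaps Xₙ with its
-- complement in 𝔅ₙ and satisfies des_B(-w) = n - des_B(w), so t^n Ψ_{C_n}(t⁻¹) is the
-- descent generating function of the complement. Adding the two gives E_{B_n}(t).

module Submission where

open import Defs
open import Data.Bool.ListAction using (any)
open import Data.Bool using (Bool; true; false; _∧_; _∨_; not; T)
open import Data.Bool.Properties using (not-involutive; T-∧)
open import Data.Empty using (⊥; ⊥-elim)
open import Data.Integer as ℤ using (ℤ; +_; -[1+_]; -_; +<+; -<+; -<-; +≤+; -≤-)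
import Data.Integer.Properties as ℤ
open import Data.Integer.Tactic.RingSolver using (solve-∀)
open import Data.Nat as ℕ using (ℕ; zero; suc; _+_; _∸_; _≤_; _<_; z≤n; s≤s)
import Data.Nat.Properties as ℕ
open import Data.List
  using (List; []; _∷_; map; _++_; length; concatMap; reverse; upTo; replicate; filter; filterᵇ)
open import Data.List.Properties
  using (∷-injectiveʳ; length-upTo; length-++; length-map; map-id; map-∘; map-cong; map-++; map-replicate;
         map-concatMap; concatMap-map; filter-++; filter-all; filter-none; filter-accept; filter-reject)
open import Data.List.Membership.Propositional using (_∈_; _∉_; find; lose)
open import Data.List.Membership.Propositional.Properties
  using (∈-++⁺ˡ; ∈-++⁺ʳ; ∈-++⁻; ∈-map⁺; ∈-map⁻; ∈-concatMap⁺; ∈-concatMap⁻;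
         ∈-filter⁺; ∈-filter⁻; ∈-upTo⁺; ∈-upTo⁻)
open import Data.List.Relation.Unary.All as All using (All; []; _∷_)
open import Data.List.Relation.Unary.Any using (here; there)
import Data.List.Relation.Unary.Any.Properties as Any
import Data.List.Relation.Unary.All.Properties as All
open import Data.List.Relation.Unary.AllPairs using ([]; _∷_)
open import Data.List.Relation.Unary.Linked as Linked using (Linked; []; [-]; _∷_)
import Data.List.Relation.Unary.Linked.Properties as Linked
open import Data.List.Relation.Unary.Linked.Properties using (AllPairs⇒Linked)
open import Data.List.Relation.Unary.Unique.Propositional using (Unique)
import Data.List.Relation.Unary.Unique.Propositional.Properties as Unique
open import Data.List.Relation.Binary.Permutation.Propositional as ↭ using (_↭_)
import Data.List.Relation.Binary.Permutation.Propositional.Properties as ↭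
open import Data.List.Relation.Binary.BagAndSetEquality using (∼bag⇒↭)
open import Data.List.Membership.Propositional.Properties.WithK using (unique∧set⇒bag)
open import Data.Product using (Σ; _×_; _,_; proj₁; proj₂)
open import Data.Sum using (_⊎_; inj₁; inj₂)
open import Data.Unit using (tt)
open import Function using (_∘_)
open import Function.Bundles using (mk⇔; Equivalence)
open import Algebra.Properties.CommutativeSemigroup ℕ.+-commutativeSemigroup
  using (interchange; x∙yz≈y∙xz; xy∙z≈xz∙y)
open import Relation.Binary.PropositionalEquality
  using (_≡_; _≢_; refl; sym; trans; cong; cong₂; subst; _≗_; module ≡-Reasoning)
open import Relation.Nullary using (¬_; yes; no; ¬?)
open import Relation.Unary using (Decidable)
open import Relation.Binary.Definitions using (DecidableEquality; tri<; tri≈; tri>)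
open import Data.List.Relation.Binary.Subset.Propositional using (_⊆_)
open import Relation.Nullary.Decidable using (⌊_⌋; toWitness; fromWitness; T?)

private variable
  A C : Set

count : (A → Bool) → List A → ℕ
count p [] = 0
count p (x ∷ xs) = b2n (p x) + count p xs

T-ext : ∀ {a b} → (T a → T b) → (T b → T a) → a ≡ b
T-ext {false} {false} f g = refl
T-ext {false} {true} f g = ⊥-elim (g tt)
T-ext {true} {false} f g = ⊥-elim (f tt)
T-ext {true} {true} f g = refl

countᵇ≡count : (p : A → Bool) (xs : List A) → countᵇ p xs ≡ count p xs
countᵇ≡count p [] = refl
countᵇ≡count p (x ∷ xs) with p x
... | true = cong suc (countᵇ≡count p xs)
... | false = countᵇ≡count p xs

filterᵇ'≗filterᵇ : (p : A → Bool) → filterᵇ' p ≗ filterᵇ p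
filterᵇ'≗filterᵇ p [] = refl
filterᵇ'≗filterᵇ p (x ∷ xs) with p x
... | true = cong (x ∷_) (filterᵇ'≗filterᵇ p xs)
... | false = filterᵇ'≗filterᵇ p xs

count-++ : (p : A → Bool) (xs ys : List A) → count p (xs ++ ys) ≡ count p xs + count p ys
count-++ p [] ys = refl
count-++ p (x ∷ xs) ys = trans (cong (_+_ (b2n (p x))) (count-++ p xs ys)) (sym (ℕ.+-assoc (b2n (p x)) _ _))

count-↭ : (p : A → Bool) {xs ys : List A} → xs ↭ ys → count p xs ≡ count p ys
count-↭ p ↭.refl = refl
count-↭ p (↭.prep x r) = cong (_+_ (b2n (p x))) (count-↭ p r)
count-↭ p (↭.swap x y r) =
  trans (x∙yz≈y∙xz (b2n (p x)) (b2n (p y)) _) (cong (λ c → b2n (p y) + (b2n (p x) + c)) (count-↭ p r))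
count-↭ p (↭.trans r s) = trans (count-↭ p r) (count-↭ p s)

count-cong : (p q : A → Bool) (xs : List A) → (∀ {x} → x ∈ xs → p x ≡ q x) → count p xs ≡ count q xs
count-cong p q [] h = refl
count-cong p q (x ∷ xs) h = cong₂ _+_ (cong b2n (h (here refl))) (count-cong p q xs (h ∘ there))

count-map : (p : C → Bool) (f : A → C) (xs : List A) → count p (map f xs) ≡ count (p ∘ f) xs
count-map p f [] = refl
count-map p f (x ∷ xs) = cong (_+_ (b2n (p (f x)))) (count-map p f xs)

count-filterᵇ : (p q : A → Bool) (xs : List A) → count p (filterᵇ q xs) ≡ count (λ x → q x ∧ p x) xs
count-filterᵇ p q [] = refl
count-filterᵇ p q (x ∷ xs) with q x
... | true = cong (_+_ (b2n (p x))) (count-filterᵇ p q xs)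
... | false = count-filterᵇ p q xs

count-split : (p q : A → Bool) (xs : List A) →
  count p xs ≡ count (λ x → q x ∧ p x) xs + count (λ x → not (q x) ∧ p x) xs
count-split p q [] = refl
count-split p q (x ∷ xs) with q x | p x
... | true | true = cong suc (count-split p q xs)
... | true | false = count-split p q xs
... | false | true = trans (cong suc (count-split p q xs)) (sym (ℕ.+-suc _ _))
... | false | false = count-split p q xs

count-+ : (p q r : A → Bool) (xs : List A) → (∀ x → b2n (p x) + b2n (q x) ≡ b2n (r x)) →
  count p xs + count q xs ≡ count r xs
count-+ p q r [] h = refl
count-+ p q r (x ∷ xs) h = trans (interchange (b2n (p x)) _ (b2n (q x)) _) (cong₂ _+_ (h x) (count-+ p q r xs h))

count-unique-≡ : ∀ {j} l → Unique l → j ∈ l → count (λ i → ⌊ i ℕ.≟ j ⌋) l ≡ 1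
count-unique-≡ {j} (i ∷ l) (i∉ ∷ _) (here refl) with i ℕ.≟ i
... | no i≢i = ⊥-elim (i≢i refl)
... | yes _ = cong suc (trans (count-cong _ (λ _ → false) l λ k∈ → absent k∈) (count-zero l))
  where
  absent : ∀ {k} → k ∈ l → ⌊ k ℕ.≟ i ⌋ ≡ false
  absent {k} k∈ with k ℕ.≟ i
  ... | yes refl = ⊥-elim (All.lookup i∉ k∈ refl)
  ... | no _ = refl
  count-zero : ∀ (xs : List ℕ) → count (λ _ → false) xs ≡ 0
  count-zero [] = refl
  count-zero (_ ∷ xs) = count-zero xs
count-unique-≡ {j} (i ∷ l) (i∉ ∷ u) (there j∈) with i ℕ.≟ j
... | yes refl = ⊥-elim (All.lookup i∉ j∈ refl)
... | no _ = count-unique-≡ l u j∈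

filterᵇ-concatMap : (q : C → Bool) (f : A → List C) (q′ : A → Bool) (xs : List A) →
  (∀ {x y} → x ∈ xs → y ∈ f x → q y ≡ q′ x) →
  filterᵇ q (concatMap f xs) ≡ concatMap f (filterᵇ q′ xs)
filterᵇ-concatMap q f q′ [] h = refl
filterᵇ-concatMap q f q′ (x ∷ xs) h with q′ x in eq
... | true = trans (filter-++ (T? ∘ q) (f x) _)
    (cong₂ _++_ (filter-all (T? ∘ q) (All.tabulate λ m → subst T (sym (trans (h (here refl) m) eq)) tt))
                (filterᵇ-concatMap q f q′ xs (h ∘ there)))
... | false = trans (filter-++ (T? ∘ q) (f x) _)
    (cong₂ _++_ (filter-none (T? ∘ q) (All.tabulate λ m → subst T (trans (h (here refl) m) eq)))
                (filterᵇ-concatMap q f q′ xs (h ∘ there)))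

↭-unique : {xs ys : List A} → xs ↭ ys → Unique xs → Unique ys
↭-unique ↭.refl u = u
↭-unique (↭.prep x r) (a ∷ u) = ↭.All-resp-↭ r a ∷ ↭-unique r u
↭-unique (↭.swap x y r) ((x≢y ∷ ax) ∷ ay ∷ u) =
  ((x≢y ∘ sym) ∷ ↭.All-resp-↭ r ay) ∷ ↭.All-resp-↭ r ax ∷ ↭-unique r u
↭-unique (↭.trans r s) u = ↭-unique s (↭-unique r u)

unique-same-elements⇒↭ : {xs ys : List A} → Unique xs → Unique ys →
  (∀ {x} → x ∈ xs → x ∈ ys) → (∀ {x} → x ∈ ys → x ∈ xs) → xs ↭ ys
unique-same-elements⇒↭ ux uy f g = ∼bag⇒↭ (unique∧set⇒bag ux uy (mk⇔ f g))

concatMap⁺ : (f : A → List C) {xs ys : List A} → xs ↭ ys → concatMap f xs ↭ concatMap f ys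
concatMap⁺ f ↭.refl = ↭.refl
concatMap⁺ f (↭.prep x r) = ↭.++⁺ˡ (f x) (concatMap⁺ f r)
concatMap⁺ f (↭.swap x y r) = ↭.trans (↭.++⁺ˡ (f x) (↭.++⁺ˡ (f y) (concatMap⁺ f r))) (↭.shifts (f x) (f y))
concatMap⁺ f (↭.trans r s) = ↭.trans (concatMap⁺ f r) (concatMap⁺ f s)

concatMap-cong-↭ : (f g : A → List C) (xs : List A) → (∀ {x} → x ∈ xs → f x ↭ g x) →
  concatMap f xs ↭ concatMap g xs
concatMap-cong-↭ f g [] h = ↭.refl
concatMap-cong-↭ f g (x ∷ xs) h = ↭.++⁺ (h (here refl)) (concatMap-cong-↭ f g xs (h ∘ there))

concatMap-unique : (f : A → List C) (key : C → A) (xs : List A) → Unique xs →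
  (∀ {x} → x ∈ xs → Unique (f x)) → (∀ {x y} → x ∈ xs → y ∈ f x → key y ≡ x) →
  Unique (concatMap f xs)
concatMap-unique f key [] u uf hk = []
concatMap-unique f key (x ∷ xs) (ax ∷ u) uf hk =
  Unique.++⁺ (uf (here refl)) (concatMap-unique f key xs u (uf ∘ there) (hk ∘ there)) disjoint
  where
  disjoint : ∀ {v} → v ∈ f x × v ∈ concatMap f xs → ⊥
  disjoint (m₁ , m₂) with find (∈-concatMap⁻ f {xs = xs} m₂)
  ... | y , y∈xs , m₃ = All.lookup ax y∈xs (trans (sym (hk (here refl) m₁)) (hk (there y∈xs) m₃))

unique-map-injective : (f : A → C) {w : List A} → Unique (map f w) →
  ∀ {x y} → x ∈ w → y ∈ w → f x ≡ f y → x ≡ y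
unique-map-injective f u (here refl) (here refl) e = refl
unique-map-injective f (fx∉ ∷ u) (here refl) (there y∈) e = ⊥-elim (All.lookup fx∉ (∈-map⁺ f y∈) e)
unique-map-injective f (fy∉ ∷ u) (there x∈) (here refl) e = ⊥-elim (All.lookup fy∉ (∈-map⁺ f x∈) (sym e))
unique-map-injective f (_ ∷ u) (there x∈) (there y∈) e = unique-map-injective f u x∈ y∈ e

data Letter (n : ℕ) : ℤ → Set where
  pos : ∀ {k} → k < n → Letter n (+ suc k)
  neg : ∀ {k} → k < n → Letter n -[1+ k ]

letter-weaken : ∀ {n c} → Letter n c → Letter (suc n) c
letter-weaken (pos k<n) = pos (ℕ.m<n⇒m<1+n k<n)
letter-weaken (neg k<n) = neg (ℕ.m<n⇒m<1+n k<n)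

letter-abs≢ : ∀ {n c} → Letter n c → absℕ c ≢ suc n
letter-abs≢ (pos k<n) refl = ℕ.<-irrefl refl k<n
letter-abs≢ (neg k<n) refl = ℕ.<-irrefl refl k<n

letter-strengthen : ∀ {n c} → Letter (suc n) c → absℕ c ≢ suc n → Letter n c
letter-strengthen (pos k<1+n) ne = pos (ℕ.≤∧≢⇒< (ℕ.≤-pred k<1+n) (ne ∘ cong suc))
letter-strengthen (neg k<1+n) ne = neg (ℕ.≤∧≢⇒< (ℕ.≤-pred k<1+n) (ne ∘ cong suc))

letter-negate : ∀ {n c} → Letter n c → Letter n (- c)
letter-negate (pos k<n) = neg k<n
letter-negate (neg k<n) = pos k<n

letter-< : ∀ {n c} → Letter n c → c ℤ.< + suc n
letter-< (pos k<n) = +<+ (s≤s k<n)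
letter-< (neg _) = -<+

letter-> : ∀ {n c} → Letter n c → -[1+ n ] ℤ.< c
letter-> (pos _) = -<+
letter-> (neg k<n) = -<- k<n

abs≡suc : ∀ {n} c → absℕ c ≡ suc n → c ≡ + suc n ⊎ c ≡ -[1+ n ]
abs≡suc (+ _) refl = inj₁ refl
abs≡suc -[1+ _ ] refl = inj₂ refl

∈-oneTo⁺ : ∀ {n k} → k < n → suc k ∈ oneTo n
∈-oneTo⁺ k<n = ∈-map⁺ suc (∈-upTo⁺ k<n)

∈-oneTo⁻ : ∀ {n j} → j ∈ oneTo n → Σ ℕ λ k → j ≡ suc k × k < n
∈-oneTo⁻ m with ∈-map⁻ suc m
... | k , k∈ , refl = k , refl , ∈-upTo⁻ k∈

oneTo-unique : ∀ n → Unique (oneTo n)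
oneTo-unique n = Unique.map⁺ ℕ.suc-injective (Unique.upTo⁺ n)

length-oneTo : ∀ n → length (oneTo n) ≡ n
length-oneTo n = trans (length-map suc (upTo n)) (length-upTo n)

letter⇒∈signed : ∀ {n c} → Letter n c → c ∈ signed n
letter⇒∈signed (pos k<n) = ∈-++⁺ʳ _ (∈-map⁺ +_ (∈-oneTo⁺ k<n))
letter⇒∈signed (neg k<n) = ∈-++⁺ˡ (∈-map⁺ (λ i → - (+ i)) (Any.reverse⁺ (∈-oneTo⁺ k<n)))

∈signed⇒letter : ∀ {n c} → c ∈ signed n → Letter n c
∈signed⇒letter {n} m with ∈-++⁻ (map (λ i → - (+ i)) (reverse (oneTo n))) m
... | inj₂ m₂ with ∈-map⁻ +_ m₂
...   | j , j∈ , refl with ∈-oneTo⁻ j∈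
...     | k , refl , k<n = pos k<n
∈signed⇒letter {n} m | inj₁ m₁ with ∈-map⁻ (λ i → - (+ i)) m₁
...   | j , j∈ , refl with ∈-oneTo⁻ {n} (Any.reverse⁻ j∈)
...     | k , refl , k<n = neg k<n

signed-unique : ∀ n → Unique (signed n)
signed-unique n = Unique.++⁺ (Unique.map⁺ negate-injective (↭-unique (↭.↭-sym (↭.↭-reverse _)) (oneTo-unique n)))
  (Unique.map⁺ ℤ.+-injective (oneTo-unique n)) disjoint
  where
  negate-injective : ∀ {i j} → - (+ i) ≡ - (+ j) → i ≡ j
  negate-injective e = ℤ.+-injective (ℤ.neg-injective e)
  disjoint : ∀ {c} → c ∈ map (λ i → - (+ i)) (reverse (oneTo n)) × c ∈ map +_ (oneTo n) → ⊥
  disjoint (m₁ , m₂) with ∈-map⁻ (λ i → - (+ i)) m₁ | ∈-map⁻ +_ m₂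
  ... | i , i∈ , refl | _ , _ , e with ∈-oneTo⁻ {n} (Any.reverse⁻ i∈)
  ...   | _ , refl , _ with () ← e

-- Pigeonhole principle for lists

module _ {A : Set} (_≟_ : DecidableEquality A) where

  private
    remove : A → List A → List A
    remove x = filter (λ y → ¬? (y ≟ x))

    length-remove : ∀ x {S} → Unique S → length S ≤ suc (length (remove x S))
    length-remove x {[]} u = z≤n
    length-remove x {y ∷ S} (y∉S ∷ u) with y ≟ x
    ... | yes refl = s≤s (ℕ.≤-reflexive (cong length (sym (filter-all (λ z → ¬? (z ≟ y))
                       (All.map (λ y≢z z≡y → y≢z (sym z≡y)) y∉S)))))
    ... | no _ = s≤s (length-remove x u)

    remove-⊆ : ∀ {x S l} → S ⊆ x ∷ l → remove x S ⊆ l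
    remove-⊆ {x} {S} S⊆ m with ∈-filter⁻ (λ y → ¬? (y ≟ x)) {xs = S} m
    ... | m′ , z≢x with S⊆ m′
    ...   | here z≡x = ⊥-elim (z≢x z≡x)
    ...   | there z∈l = z∈l

  unique-⊆⇒length≤ : ∀ {S} l → Unique S → S ⊆ l → length S ≤ length l
  unique-⊆⇒length≤ {[]} [] u S⊆ = z≤n
  unique-⊆⇒length≤ {_ ∷ _} [] u S⊆ with () ← S⊆ (here refl)
  unique-⊆⇒length≤ {S} (x ∷ l) u S⊆ = ℕ.≤-trans (length-remove x u)
    (s≤s (unique-⊆⇒length≤ l (Unique.filter⁺ _ u) (remove-⊆ S⊆)))

  covering⇒unique : ∀ {S} l → Unique S → S ⊆ l → length l ≤ length S → Unique l
  covering⇒unique [] u S⊆ le = []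
  covering⇒unique {S} (x ∷ l) u S⊆ le =
    All.tabulate x∉l ∷ covering⇒unique l (Unique.filter⁺ _ u) (remove-⊆ S⊆)
      (ℕ.≤-pred (ℕ.≤-trans le (length-remove x u)))
    where
    x∉l : ∀ {y} → y ∈ l → x ≢ y
    x∉l {y} y∈l refl = ℕ.<-irrefl refl (ℕ.≤-trans le (unique-⊆⇒length≤ l u S⊆l))
      where
      S⊆l : S ⊆ l
      S⊆l m with S⊆ m
      ... | here refl = y∈l
      ... | there m′ = m′

∈-words⁻ : ∀ n k {w} → w ∈ words n k → length w ≡ k × All (Letter n) w
∈-words⁻ n zero (here refl) = refl , []
∈-words⁻ n (suc k) m with find (∈-concatMap⁻ (λ c → map (c ∷_) (words n k)) {xs = signed n} m)
... | c , c∈ , m′ with ∈-map⁻ (c ∷_) m′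
...   | w , w∈ , refl with ∈-words⁻ n k w∈
...     | len , letters = cong suc len , ∈signed⇒letter c∈ ∷ letters

∈-words⁺ : ∀ n {w} → All (Letter n) w → w ∈ words n (length w)
∈-words⁺ n [] = here refl
∈-words⁺ n {c ∷ w} (lc ∷ lw) =
  ∈-concatMap⁺ (λ d → map (d ∷_) (words n (length w)))
    (lose (letter⇒∈signed lc) (∈-map⁺ (c ∷_) (∈-words⁺ n lw)))

words-unique : ∀ n k → Unique (words n k)
words-unique n zero = [] ∷ []
words-unique n (suc k) = concatMap-unique (λ c → map (c ∷_) (words n k)) head (signed n) (signed-unique n)
  (λ _ → Unique.map⁺ ∷-injectiveʳ (words-unique n k)) head-of
  where
  head : List ℤ → ℤ
  head [] = + 0
  head (c ∷ _) = c
  head-of : ∀ {c w} → c ∈ signed n → w ∈ map (c ∷_) (words n k) → head w ≡ c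
  head-of {c} _ m with ∈-map⁻ (c ∷_) m
  ... | _ , _ , refl = refl

Covers : ℕ → List ℤ → Set
Covers n w = ∀ {k} → k < n → suc k ∈ map absℕ w

covers⇒isSignedPerm : ∀ n w → Covers n w → T (isSignedPerm n w)
covers⇒isSignedPerm n w cov = All.all⁻ _ (All.tabulate λ m → witness (∈-oneTo⁻ m))
  where
  witness : ∀ {j} → Σ ℕ (λ k → j ≡ suc k × k < n) → T (any (λ c → ⌊ absℕ c ℕ.≟ j ⌋) w)
  witness (k , refl , k<n) with ∈-map⁻ absℕ (cov k<n)
  ... | c , c∈ , e = Any.any⁺ _ (lose c∈ (fromWitness (sym e)))

isSignedPerm⇒covers : ∀ n w → T (isSignedPerm n w) → Covers n w
isSignedPerm⇒covers n w t k<n with find (Any.any⁻ _ w (All.lookup (All.all⁺ _ (oneTo n) t) (∈-oneTo⁺ k<n)))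
... | c , c∈ , e = subst (_∈ map absℕ w) (toWitness e) (∈-map⁺ absℕ c∈)

record IsWindow (n : ℕ) (w : List ℤ) : Set where
  field
    length≡ : length w ≡ n
    letters : All (Letter n) w
    covers  : Covers n w

∈B⁻ : ∀ {n w} → w ∈ B n → IsWindow n w
∈B⁻ {n} {w} m
  with ∈-filter⁻ (T? ∘ isSignedPerm n) {xs = words n n} (subst (w ∈_) (filterᵇ'≗filterᵇ _ (words n n)) m)
... | w∈ , t with ∈-words⁻ n n w∈
...   | len , letters = record { length≡ = len ; letters = letters ; covers = isSignedPerm⇒covers n w t }

∈B⁺ : ∀ {n w} → IsWindow n w → w ∈ B n
∈B⁺ {n} {w} win = subst (w ∈_) (sym (filterᵇ'≗filterᵇ _ (words n n)))
  (∈-filter⁺ (T? ∘ isSignedPerm n) (subst (λ k → w ∈ words n k) length≡ (∈-words⁺ n letters))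
    (covers⇒isSignedPerm n w covers))
  where open IsWindow win

B-unique : ∀ n → Unique (B n)
B-unique n = subst Unique (sym (filterᵇ'≗filterᵇ _ (words n n))) (Unique.filter⁺ _ (words-unique n n))

window-abs-unique : ∀ {n w} → IsWindow n w → Unique (map absℕ w)
window-abs-unique {n} {w} win = covering⇒unique ℕ._≟_ (map absℕ w) (oneTo-unique n)
  (λ m → let (k , e , k<n) = ∈-oneTo⁻ m in subst (_∈ map absℕ w) (sym e) (covers k<n))
  (ℕ.≤-reflexive (trans (length-map absℕ w) (trans length≡ (sym (length-oneTo n)))))
  where open IsWindow win

negate : List ℤ → List ℤ
negate = map -_

negate-involutive : ∀ w → negate (negate w) ≡ w
negate-involutive w = trans (sym (map-∘ w)) (trans (map-cong ℤ.neg-involutive w) (map-id w))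

abs-negate : ∀ c → absℕ (- c) ≡ absℕ c
abs-negate (+ zero) = refl
abs-negate (+ suc _) = refl
abs-negate -[1+ _ ] = refl

window-negate : ∀ {n w} → IsWindow n w → IsWindow n (negate w)
window-negate {n} {w} win = record
  { length≡ = trans (length-map -_ w) length≡
  ; letters = All.map⁺ (All.map letter-negate letters)
  ; covers = λ k<n → subst (_ ∈_) abs-map (covers k<n)
  }
  where
  open IsWindow win
  abs-map : map absℕ w ≡ map absℕ (negate w)
  abs-map = trans (map-cong (sym ∘ abs-negate) w) (map-∘ w)

negate-B-↭ : ∀ n → map negate (B n) ↭ B n
negate-B-↭ n = unique-same-elements⇒↭
  (Unique.map⁺ (λ {v} {w} e → trans (sym (negate-involutive v)) (trans (cong negate e) (negate-involutive w))) (B-unique n))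
  (B-unique n)
  (λ m → let (w , w∈ , e) = ∈-map⁻ negate m in subst (_∈ B n) (sym e) (∈B⁺ (window-negate (∈B⁻ {n} w∈))))
  (λ {w} w∈ → subst (_∈ map negate (B n)) (negate-involutive w)
    (∈-map⁺ negate (∈B⁺ (window-negate (∈B⁻ {n} w∈)))))

count-B-negate : ∀ n (p : List ℤ → Bool) → count p (B n) ≡ count (p ∘ negate) (B n)
count-B-negate n p = trans (sym (count-↭ p (negate-B-↭ n))) (count-map p negate (B n))

inX⇒1∈ : ∀ w → T (inX w) → + 1 ∈ w
inX⇒1∈ w t with find (Any.any⁻ _ w t)
... | c , c∈ , e = subst (_∈ w) (toWitness e) c∈

1∈⇒inX : ∀ w → + 1 ∈ w → T (inX w)
1∈⇒inX w m = Any.any⁺ _ (lose m (fromWitness {a? = + 1 ℤ.≟ + 1} refl))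

inX-negate : ∀ {n w} → 1 ≤ n → IsWindow n w → inX (negate w) ≡ not (inX w)
inX-negate {n} {w} 1≤n win with inX w in eq
... | true = T-ext (λ t → 1∉-1 (inX⇒1∈ w (subst T (sym eq) tt)) (negate-1∈ (inX⇒1∈ (negate w) t))) λ ()
  where
  negate-1∈ : + 1 ∈ negate w → -[1+ 0 ] ∈ w
  negate-1∈ m with ∈-map⁻ -_ m
  ... | c , c∈ , e = subst (_∈ w) (trans (sym (ℤ.neg-involutive c)) (cong -_ (sym e))) c∈
  1∉-1 : + 1 ∈ w → -[1+ 0 ] ∈ w → ⊥
  1∉-1 m₁ m₂ with () ← unique-map-injective absℕ (window-abs-unique win) m₁ m₂ refl
... | false = T-ext (λ _ → tt) λ _ → 1∈⇒inX (negate w) (∈-map⁺ -_ -1∈w)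
  where
  -1∈w : -[1+ 0 ] ∈ w
  -1∈w with ∈-map⁻ absℕ (IsWindow.covers win 1≤n)
  ... | + .1 , c∈ , refl = ⊥-elim (subst T eq (1∈⇒inX w c∈))
  ... | -[1+ .0 ] , c∈ , refl = c∈

desc-negate : ∀ {x y} → x ≢ y → b2n ⌊ - y ℤ.<? - x ⌋ + b2n ⌊ y ℤ.<? x ⌋ ≡ 1
desc-negate {x} {y} x≢y with ℤ.<-cmp x y
... | tri≈ _ x≡y _ = ⊥-elim (x≢y x≡y)
... | tri< x<y _ _ with - y ℤ.<? - x | y ℤ.<? x
...   | yes _ | no _ = refl
...   | no ¬p | _ = ⊥-elim (¬p (ℤ.neg-mono-< x<y))
...   | yes _ | yes y<x = ⊥-elim (ℤ.<-asym x<y y<x)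
desc-negate {x} {y} x≢y | tri> _ _ y<x with - y ℤ.<? - x | y ℤ.<? x
...   | no _ | yes _ = refl
...   | yes p | _ = ⊥-elim (ℤ.<-asym p (ℤ.neg-mono-< y<x))
...   | no _ | no ¬y<x = ⊥-elim (¬y<x y<x)

countDesc-negate : ∀ {l} → Linked _≢_ l → countDesc (negate l) + countDesc l ≡ ℕ.pred (length l)
countDesc-negate [] = refl
countDesc-negate [-] = refl
countDesc-negate {x ∷ y ∷ l} (x≢y ∷ linked) = begin
  (b2n ⌊ - y ℤ.<? - x ⌋ + countDesc (negate (y ∷ l))) + (b2n ⌊ y ℤ.<? x ⌋ + countDesc (y ∷ l))
    ≡⟨ interchange (b2n ⌊ - y ℤ.<? - x ⌋) _ _ _ ⟩
  (b2n ⌊ - y ℤ.<? - x ⌋ + b2n ⌊ y ℤ.<? x ⌋) + (countDesc (negate (y ∷ l)) + countDesc (y ∷ l))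
    ≡⟨ cong₂ _+_ (desc-negate x≢y) (countDesc-negate linked) ⟩
  suc (length l) ∎
  where open ≡-Reasoning

-- Prepending w₀ = 0 keeps neighbours distinct since no letter has absolute value 0.
desB-negate : ∀ {n w} → IsWindow n w → desB (negate w) + desB w ≡ n
desB-negate {n} {w} win =
  trans (countDesc-negate (Linked.map abs≢⇒≢ (Linked.map⁻ (AllPairs⇒Linked abs-unique)))) length≡
  where
  open IsWindow win
  abs≢⇒≢ : ∀ {x y} → absℕ x ≢ absℕ y → x ≢ y
  abs≢⇒≢ ne = ne ∘ cong absℕ
  abs-unique : Unique (0 ∷ map absℕ w)
  abs-unique = All.map⁺ (All.map (λ { (pos _) () ; (neg _) () }) letters) ∷ window-abs-unique win

-- Inserting the letter ±(n+1) into a window of 𝔅ₙ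

insertions : ℤ → List ℤ → List (List ℤ)
insertions x [] = (x ∷ []) ∷ []
insertions x (y ∷ w) = (x ∷ y ∷ w) ∷ map (y ∷_) (insertions x w)

record IsInsertion (x : ℤ) (w u : List ℤ) : Set where
  field
    inserted : x ∈ u
    ⊆x∷w : u ⊆ x ∷ w
    ⊇w : w ⊆ u
    length≡ : length u ≡ suc (length w)

∈-insertions⁻ : ∀ x w {u} → u ∈ insertions x w → IsInsertion x w u
∈-insertions⁻ x [] (here refl) =
  record { inserted = here refl ; ⊆x∷w = λ m → m ; ⊇w = λ () ; length≡ = refl }
∈-insertions⁻ x (y ∷ w) (here refl) =
  record { inserted = here refl ; ⊆x∷w = λ m → m ; ⊇w = there ; length≡ = refl }
∈-insertions⁻ x (y ∷ w) (there m) with ∈-map⁻ (y ∷_) m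
... | u , u∈ , refl = record
  { inserted = there inserted
  ; ⊆x∷w = λ { (here e) → there (here e) ; (there z∈u) → swap-head (⊆x∷w z∈u) }
  ; ⊇w = λ { (here e) → here e ; (there z∈w) → there (⊇w z∈w) }
  ; length≡ = cong suc length≡
  }
  where
  open IsInsertion (∈-insertions⁻ x w u∈)
  swap-head : ∀ {z} → z ∈ x ∷ w → z ∈ x ∷ y ∷ w
  swap-head (here e) = here e
  swap-head (there m′) = there (there m′)

insertions-unique : ∀ x w → x ∉ w → Unique (insertions x w)
insertions-unique x [] _ = [] ∷ []
insertions-unique x (y ∷ w) x∉ =
  All.tabulate head≢ ∷ Unique.map⁺ ∷-injectiveʳ (insertions-unique x w (x∉ ∘ there))
  where
  head≢ : ∀ {v} → v ∈ map (y ∷_) (insertions x w) → x ∷ y ∷ w ≢ v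
  head≢ m e with ∈-map⁻ (y ∷_) m
  ... | _ , _ , refl with refl ← e = x∉ (here refl)

abs≢? : (N : ℕ) → Decidable (λ z → absℕ z ≢ N)
abs≢? N z = ¬? (absℕ z ℕ.≟ N)

delete : ℕ → List ℤ → List ℤ
delete N = filter (abs≢? N)

delete-insertion : ∀ {N} x w {u} → absℕ x ≡ N → All (λ z → absℕ z ≢ N) w →
  u ∈ insertions x w → delete N u ≡ w
delete-insertion {N} x [] ex ok (here refl) = filter-reject (abs≢? N) {x} {[]} (λ ne → ne ex)
delete-insertion {N} x (y ∷ w) ex ok (here refl) =
  trans (filter-reject (abs≢? N) {x} {y ∷ w} (λ ne → ne ex)) (filter-all (abs≢? N) ok)
delete-insertion {N} x (y ∷ w) ex (oky ∷ ok) (there m) with ∈-map⁻ (y ∷_) m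
... | u , u∈ , refl = trans (filter-accept (abs≢? N) {y} {u} oky) (cong (y ∷_) (delete-insertion x w ex ok u∈))

∈-insertions-delete : ∀ {N x u} → x ∈ u → absℕ x ≡ N → Unique (map absℕ u) → u ∈ insertions x (delete N u)
∈-insertions-delete {N} {u = z ∷ u} (here refl) ex (z∉ ∷ _) =
  subst (λ v → (z ∷ u) ∈ insertions z v) (sym deleted) (head-insertion u)
  where
  deleted : delete N (z ∷ u) ≡ u
  deleted = trans (filter-reject (abs≢? N) {z} {u} (λ ne → ne ex))
    (filter-all (abs≢? N) (All.tabulate λ y∈ e → All.lookup z∉ (∈-map⁺ absℕ y∈) (trans ex (sym e))))
  head-insertion : ∀ w → (z ∷ w) ∈ insertions z w
  head-insertion [] = here refl
  head-insertion (_ ∷ _) = here refl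
∈-insertions-delete {N} {u = z ∷ u} (there x∈) ex (z∉ ∷ u-unique) =
  subst (λ v → (z ∷ u) ∈ insertions _ v) (sym kept) (there (∈-map⁺ (z ∷_) (∈-insertions-delete x∈ ex u-unique)))
  where
  kept : delete N (z ∷ u) ≡ z ∷ delete N u
  kept = filter-accept (abs≢? N) {z} {u} (λ e → All.lookup z∉ (∈-map⁺ absℕ x∈) (trans e (sym ex)))

extensions : ℕ → List ℤ → List (List ℤ)
extensions n w = insertions (+ suc n) w ++ insertions -[1+ n ] w

∈-extensions⁻ : ∀ n w {u} → u ∈ extensions n w → Σ ℤ λ x → absℕ x ≡ suc n × IsInsertion x w u
∈-extensions⁻ n w m with ∈-++⁻ (insertions (+ suc n) w) m
... | inj₁ m₁ = + suc n , refl , ∈-insertions⁻ _ w m₁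
... | inj₂ m₂ = -[1+ n ] , refl , ∈-insertions⁻ _ w m₂

module _ {n w} (win : IsWindow n w) where
  open IsWindow win

  window-extension : ∀ {u} → u ∈ extensions n w → IsWindow (suc n) u
  window-extension m with ∈-extensions⁻ n w m
  ... | x , ex , ins = record
    { length≡ = trans (IsInsertion.length≡ ins) (cong suc length≡)
    ; letters = All.tabulate (letter ∘ IsInsertion.⊆x∷w ins)
    ; covers = cover
    }
    where
    letter : ∀ {z} → z ∈ x ∷ w → Letter (suc n) z
    letter (here refl) with abs≡suc x ex
    ... | inj₁ refl = pos ℕ.≤-refl
    ... | inj₂ refl = neg ℕ.≤-refl
    letter (there z∈w) = letter-weaken (All.lookup letters z∈w)
    cover : Covers (suc n) _
    cover {k} k<1+n with k ℕ.≟ n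
    ... | yes refl = subst (_∈ _) ex (∈-map⁺ absℕ (IsInsertion.inserted ins))
    ... | no k≢n with ∈-map⁻ absℕ (covers (ℕ.≤∧≢⇒< (ℕ.≤-pred k<1+n) k≢n))
    ...   | z , z∈w , e = subst (_∈ _) (sym e) (∈-map⁺ absℕ (IsInsertion.⊇w ins z∈w))

  delete-extension : ∀ {u} → u ∈ extensions n w → delete (suc n) u ≡ w
  delete-extension m with ∈-++⁻ (insertions (+ suc n) w) m
  ... | inj₁ m₁ = delete-insertion _ w refl (All.map letter-abs≢ letters) m₁
  ... | inj₂ m₂ = delete-insertion _ w refl (All.map letter-abs≢ letters) m₂

  extensions-unique : Unique (extensions n w)
  extensions-unique = Unique.++⁺ (insertions-unique _ w (fresh refl)) (insertions-unique _ w (fresh refl)) disjoint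
    where
    fresh : ∀ {x} → absℕ x ≡ suc n → x ∉ w
    fresh ex x∈w = letter-abs≢ (All.lookup letters x∈w) ex
    disjoint : ∀ {u} → u ∈ insertions (+ suc n) w × u ∈ insertions -[1+ n ] w → ⊥
    disjoint (m₁ , m₂)
      with IsInsertion.⊆x∷w (∈-insertions⁻ _ w m₂) (IsInsertion.inserted (∈-insertions⁻ _ w m₁))
    ... | there x∈w = fresh refl x∈w

module _ {n u} (win : IsWindow (suc n) u) where
  open IsWindow win

  ∈-extensions-delete : u ∈ extensions n (delete (suc n) u)
  ∈-extensions-delete with ∈-map⁻ absℕ (covers (ℕ.n<1+n n))
  ... | x , x∈u , e with abs≡suc x (sym e) | ∈-insertions-delete x∈u (sym e) (window-abs-unique win)
  ...   | inj₁ refl | m = ∈-++⁺ˡ m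
  ...   | inj₂ refl | m = ∈-++⁺ʳ _ m

  window-delete : IsWindow n (delete (suc n) u)
  window-delete = record
    { length≡ = ℕ.suc-injective (trans (sym (IsInsertion.length≡ ins)) length≡)
    ; letters = All.tabulate λ m → let (z∈u , ne) = ∈-filter⁻ (abs≢? (suc n)) {xs = u} m in
                  letter-strengthen (All.lookup letters z∈u) ne
    ; covers = cover
    }
    where
    ins = proj₂ (proj₂ (∈-extensions⁻ n (delete (suc n) u) ∈-extensions-delete))
    cover : Covers n (delete (suc n) u)
    cover k<n with ∈-map⁻ absℕ (covers (ℕ.m<n⇒m<1+n k<n))
    ... | z , z∈u , e = subst (_∈ _) (sym e)
      (∈-map⁺ absℕ (∈-filter⁺ (abs≢? (suc n)) z∈u λ ez → ℕ.<-irrefl (ℕ.suc-injective (trans e ez)) k<n))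

B-suc-↭ : ∀ n → B (suc n) ↭ concatMap (extensions n) (B n)
B-suc-↭ n = unique-same-elements⇒↭ (B-unique (suc n))
  (concatMap-unique (extensions n) (delete (suc n)) (B n) (B-unique n)
    (λ w∈ → extensions-unique (∈B⁻ w∈)) (λ w∈ → delete-extension (∈B⁻ w∈)))
  (λ u∈ → let win = ∈B⁻ {suc n} u∈ in
    ∈-concatMap⁺ (extensions n) (lose (∈B⁺ (window-delete win)) (∈-extensions-delete win)))
  (λ m → let (w , w∈ , u∈) = find (∈-concatMap⁻ (extensions n) {xs = B n} m) in
    ∈B⁺ (window-extension (∈B⁻ w∈) u∈))

X : ℕ → List (List ℤ)
X n = filterᵇ inX (B n)

∈X⇒∈B : ∀ {n w} → w ∈ X n → w ∈ B n
∈X⇒∈B {n} w∈ = proj₁ (∈-filter⁻ (T? ∘ inX) {xs = B n} w∈)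

inX-extension : ∀ {m w u} → u ∈ extensions (suc m) w → inX u ≡ inX w
inX-extension {m} {w} m∈ with ∈-extensions⁻ (suc m) w m∈
... | x , ex , ins = T-ext (λ t → 1∈⇒inX w (1∈w (IsInsertion.⊆x∷w ins (inX⇒1∈ _ t))))
                          (λ t → 1∈⇒inX _ (IsInsertion.⊇w ins (inX⇒1∈ w t)))
  where
  1∈w : + 1 ∈ x ∷ w → + 1 ∈ w
  1∈w (here e) with () ← ℕ.suc-injective (trans (cong absℕ e) ex)
  1∈w (there m) = m

X-suc-↭ : ∀ m → X (suc (suc m)) ↭ concatMap (extensions (suc m)) (X (suc m))
X-suc-↭ m = ↭.trans (↭.filter-↭ (T? ∘ inX) (B-suc-↭ (suc m)))
  (↭.↭-reflexive (filterᵇ-concatMap inX (extensions (suc m)) inX (B (suc m)) (λ {w} _ → inX-extension {m} {w})))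

Between : ℕ → ℤ → ℤ → Set
Between n a b = Σ ℤ λ c → Letter n c × a ℤ.< c × c ℤ.< b

ll-sound : ∀ n a b → T (ll n a b) → Between n a b
ll-sound n a b t with find (Any.any⁻ _ (signed n) t)
... | c , c∈ , t′ with Equivalence.to (T-∧ {⌊ a ℤ.<? c ⌋}) t′
...   | a<c , c<b = c , ∈signed⇒letter c∈ , toWitness a<c , toWitness c<b

ll-complete : ∀ n a b → Between n a b → T (ll n a b)
ll-complete n a b (c , lc , a<c , c<b) =
  Any.any⁺ _ (lose (letter⇒∈signed lc) (Equivalence.from (T-∧ {⌊ a ℤ.<? c ⌋}) (fromWitness a<c , fromWitness c<b)))

ll-false : ∀ n a b → ¬ Between n a b → ll n a b ≡ false
ll-false n a b ¬between = T-ext (λ t → ¬between (ll-sound n a b t)) λ ()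

ll-≡ : ∀ n a b {β} → (T (ll n a b) → T β) → (T β → Between n a b) → ll n a b ≡ β
ll-≡ n a b f g = T-ext f (ll-complete n a b ∘ g)

ll-start : ∀ {n} → 1 ≤ n → ∀ y → ll n -[1+ 0 ] y ≡ ⌊ + 2 ℤ.≤? y ⌋
ll-start {n} 1≤n y = ll-≡ n _ y sound complete
  where
  sound : T (ll n -[1+ 0 ] y) → T ⌊ + 2 ℤ.≤? y ⌋
  sound t with ll-sound n _ y t
  ... | + suc _ , _ , _ , +<+ c<y = fromWitness (+≤+ (ℕ.≤-trans (s≤s (s≤s z≤n)) c<y))
  ... | -[1+ _ ] , _ , -<- () , _
  complete : T ⌊ + 2 ℤ.≤? y ⌋ → Between n -[1+ 0 ] y
  complete t with toWitness t
  ... | +≤+ (s≤s 1≤y) = + 1 , pos 1≤n , -<+ , +<+ (s≤s 1≤y)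

ll-end : ∀ {n} → 1 ≤ n → ∀ z → ll n z (+ 1) ≡ ⌊ z ℤ.≤? -[1+ 1 ] ⌋
ll-end {n} 1≤n z = ll-≡ n z _ sound complete
  where
  sound : T (ll n z (+ 1)) → T ⌊ z ℤ.≤? -[1+ 1 ] ⌋
  sound t with ll-sound n z _ t
  ... | + suc _ , _ , _ , +<+ (s≤s ())
  ... | -[1+ _ ] , _ , -<- z<c , _ = fromWitness (-≤- (ℕ.≤-trans (s≤s z≤n) z<c))
  complete : T ⌊ z ℤ.≤? -[1+ 1 ] ⌋ → Between n z (+ 1)
  complete t with toWitness t
  ... | -≤- 1≤z = -[1+ 0 ] , neg 1≤n , -<- 1≤z , -<+

ll-start-end : ∀ n → ll n -[1+ 0 ] (+ 1) ≡ false
ll-start-end n = ll-false n _ _ λ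
  { (+ suc _ , _ , _ , +<+ (s≤s ()))
  ; (-[1+ _ ] , _ , -<- () , _) }

letter-between : ∀ {n a b c} → Letter (suc n) c → Letter n a → Letter n b → a ℤ.< c → c ℤ.< b → Letter n c
letter-between (pos k<1+n) _ _ _ _ with ℕ.m<1+n⇒m<n∨m≡n k<1+n
... | inj₁ k<n = pos k<n
letter-between (pos _) _ (pos j<n) _ (+<+ (s≤s n<j)) | inj₂ refl = ⊥-elim (ℕ.<-asym j<n n<j)
letter-between (neg k<1+n) _ _ _ _ with ℕ.m<1+n⇒m<n∨m≡n k<1+n
... | inj₁ k<n = neg k<n
letter-between (neg _) (neg j<n) _ (-<- n<j) _ | inj₂ refl = ⊥-elim (ℕ.<-asym j<n n<j)

ll-weaken : ∀ n {a b} → Letter n a → Letter n b → ll (suc n) a b ≡ ll n a b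
ll-weaken n {a} {b} la lb = ll-≡ (suc n) a b
  (λ t → let (c , lc , a<c , c<b) = ll-sound (suc n) a b t in
           ll-complete n a b (c , letter-between lc la lb a<c c<b , a<c , c<b))
  (λ t → let (c , lc , a<c , c<b) = ll-sound n a b t in c , letter-weaken lc , a<c , c<b)

ll-from-top : ∀ n y → ll (suc n) (+ suc n) y ≡ false
ll-from-top n y = ll-false (suc n) _ y λ
  { (+ suc _ , pos k<1+n , +<+ (s≤s n<k) , _) → ℕ.<⇒≱ k<1+n n<k }

ll-to-bottom : ∀ n a → ll (suc n) a -[1+ n ] ≡ false
ll-to-bottom n a = ll-false (suc n) a _ λ
  { (-[1+ _ ] , neg k<1+n , _ , -<- n<k) → ℕ.<⇒≱ k<1+n n<k }

ll-to-top : ∀ {m a} → Letter (suc m) a → ll (suc (suc m)) a (+ suc (suc m)) ≡ not ⌊ a ℤ.≟ + suc m ⌋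
ll-to-top {m} {a} la = ll-≡ (suc (suc m)) a _ sound complete
  where
  sound : T (ll (suc (suc m)) a (+ suc (suc m))) → T (not ⌊ a ℤ.≟ + suc m ⌋)
  sound t with a ℤ.≟ + suc m
  ... | no _ = tt
  ... | yes refl with ll-sound (suc (suc m)) (+ suc m) (+ suc (suc m)) t
  ...   | + _ , _ , +<+ m<k , +<+ k<m = ℕ.<⇒≱ m<k (ℕ.≤-pred k<m)
  complete : T (not ⌊ a ℤ.≟ + suc m ⌋) → Between (suc (suc m)) a (+ suc (suc m))
  complete t = + suc m , pos (ℕ.m<n⇒m<1+n (ℕ.n<1+n m)) , below la , +<+ ℕ.≤-refl
    where
    below : Letter (suc m) a → a ℤ.< + suc m
    below (neg _) = -<+
    below (pos {k} k<1+m) with ℕ.m<1+n⇒m<n∨m≡n k<1+m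
    ... | inj₁ k<m = +<+ (s≤s k<m)
    ... | inj₂ refl with a ℤ.≟ + suc m
    ...   | yes _ = ⊥-elim t
    ...   | no a≢m = ⊥-elim (a≢m refl)

ll-from-bottom : ∀ {m y} → Letter (suc m) y → ll (suc (suc m)) -[1+ suc m ] y ≡ not ⌊ y ℤ.≟ -[1+ m ] ⌋
ll-from-bottom {m} {y} ly = ll-≡ (suc (suc m)) _ y sound complete
  where
  sound : T (ll (suc (suc m)) -[1+ suc m ] y) → T (not ⌊ y ℤ.≟ -[1+ m ] ⌋)
  sound t with y ℤ.≟ -[1+ m ]
  ... | no _ = tt
  ... | yes refl with ll-sound (suc (suc m)) -[1+ suc m ] -[1+ m ] t
  ...   | -[1+ _ ] , _ , -<- k<1+m , -<- m<k = ℕ.<⇒≱ m<k (ℕ.≤-pred k<1+m)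
  complete : T (not ⌊ y ℤ.≟ -[1+ m ] ⌋) → Between (suc (suc m)) -[1+ suc m ] y
  complete t = -[1+ m ] , neg (ℕ.m<n⇒m<1+n (ℕ.n<1+n m)) , -<- ℕ.≤-refl , above ly
    where
    above : Letter (suc m) y → -[1+ m ] ℤ.< y
    above (pos _) = -<+
    above (neg {k} k<1+m) with ℕ.m<1+n⇒m<n∨m≡n k<1+m
    ... | inj₁ k<m = -<- k<m
    ... | inj₂ refl with y ℤ.≟ -[1+ m ]
    ...   | yes _ = ⊥-elim t
    ...   | no y≢m = ⊥-elim (y≢m refl)

-- Statistics of the 2(n+1) extensions of a window

profile : ℕ → ℕ → List ℕ
profile n s = replicate (suc (s + s)) s ++ replicate (suc n + suc n ∸ suc (s + s)) (suc s)

bits-sort : ∀ bs → bs ↭ replicate (count not bs) false ++ replicate (count (λ b → b) bs) true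
bits-sort [] = ↭.refl
bits-sort (false ∷ bs) = ↭.prep false (bits-sort bs)
bits-sort (true ∷ bs) =
  ↭.trans (↭.prep true (bits-sort bs)) (↭.↭-sym (↭.shift true (replicate (count not bs) false) _))

count-not+count-id : ∀ bs → count not bs + count (λ b → b) bs ≡ length bs
count-not+count-id [] = refl
count-not+count-id (false ∷ bs) = cong suc (count-not+count-id bs)
count-not+count-id (true ∷ bs) = trans (ℕ.+-suc _ _) (cong suc (count-not+count-id bs))

-- Position i of bs records whether the i-th extension has statistic s + 1 rather than s.
increments-↭-profile : ∀ n s bs → count not bs ≡ suc (s + s) → length bs ≡ suc n + suc n →
  map (λ b → s + b2n b) bs ↭ profile n s
increments-↭-profile n s bs zeros len = begin
  map f bs
    ↭⟨ ↭.map⁺ f (bits-sort bs) ⟩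
  map f (replicate (count not bs) false ++ replicate (count (λ b → b) bs) true)
    ≡⟨ map-++ f (replicate (count not bs) false) _ ⟩
  map f (replicate (count not bs) false) ++ map f (replicate (count (λ b → b) bs) true)
    ≡⟨ cong₂ _++_ (trans (map-replicate f _ false) (cong₂ replicate zeros (ℕ.+-identityʳ s)))
                  (trans (map-replicate f _ true) (cong₂ replicate ones (ℕ.+-comm s 1))) ⟩
  profile n s ∎
  where
  open ↭.PermutationReasoning
  f : Bool → ℕ
  f b = s + b2n b
  ones : count (λ b → b) bs ≡ suc n + suc n ∸ suc (s + s)
  ones = trans (sym (ℕ.m+n∸m≡n (count not bs) _)) (cong₂ _∸_ (trans (count-not+count-id bs) len) zeros)

map-+-increments : ∀ e c (g : A → ℕ) xs bs → map g xs ≡ map (λ b → c + b2n b) bs →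
  map (λ x → e + g x) xs ≡ map (λ b → (e + c) + b2n b) bs
map-+-increments e c g xs bs eq = begin
  map (λ x → e + g x) xs                   ≡⟨ map-∘ xs ⟩
  map (_+_ e) (map g xs)                   ≡⟨ cong (map (_+_ e)) eq ⟩
  map (_+_ e) (map (λ b → c + b2n b) bs)   ≡⟨ map-∘ bs ⟨
  map (λ b → e + (c + b2n b)) bs           ≡⟨ map-cong (λ b → sym (ℕ.+-assoc e c (b2n b))) bs ⟩
  map (λ b → (e + c) + b2n b) bs           ∎
  where open ≡-Reasoning

Extremal : ℤ → List ℤ → Set
Extremal x l = All (ℤ._< x) l ⊎ All (x ℤ.<_) l

extremal-tail : ∀ {x a l} → Extremal x (a ∷ l) → Extremal x l
extremal-tail (inj₁ (_ ∷ l<x)) = inj₁ l<x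
extremal-tail (inj₂ (_ ∷ x<l)) = inj₂ x<l

extremal-descents : ∀ {x a y l} → Extremal x (a ∷ y ∷ l) → b2n ⌊ x ℤ.<? a ⌋ + b2n ⌊ y ℤ.<? x ⌋ ≡ 1
extremal-descents {x} {a} {y} (inj₁ (a<x ∷ y<x ∷ _)) with x ℤ.<? a | y ℤ.<? x
... | no _ | yes _ = refl
... | yes x<a | _ = ⊥-elim (ℤ.<-asym a<x x<a)
... | no _ | no ¬y<x = ⊥-elim (¬y<x y<x)
extremal-descents {x} {a} {y} (inj₂ (x<a ∷ x<y ∷ _)) with x ℤ.<? a | y ℤ.<? x
... | yes _ | no _ = refl
... | no ¬x<a | _ = ⊥-elim (¬x<a x<a)
... | yes _ | yes y<x = ⊥-elim (ℤ.<-asym x<y y<x)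

descent-increments : ℤ → ℤ → List ℤ → List Bool
descent-increments x a [] = ⌊ x ℤ.<? a ⌋ ∷ []
descent-increments x a (y ∷ w) = not ⌊ y ℤ.<? a ⌋ ∷ descent-increments x y w

length-descent-increments : ∀ x a w → length (descent-increments x a w) ≡ suc (length w)
length-descent-increments x a [] = refl
length-descent-increments x a (y ∷ w) = cong suc (length-descent-increments x y w)

countDesc-insertions : ∀ x a w → Extremal x (a ∷ w) →
  map (countDesc ∘ (a ∷_)) (insertions x w) ≡ map (λ b → countDesc (a ∷ w) + b2n b) (descent-increments x a w)
countDesc-insertions x a [] _ = cong (_∷ []) (ℕ.+-identityʳ _)
countDesc-insertions x a (y ∷ w) ext = cong₂ _∷_ first rest
  where
  d = ⌊ y ℤ.<? a ⌋
  c = countDesc (y ∷ w)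
  first : b2n ⌊ x ℤ.<? a ⌋ + (b2n ⌊ y ℤ.<? x ⌋ + c) ≡ (b2n d + c) + b2n (not d)
  first = begin
    b2n ⌊ x ℤ.<? a ⌋ + (b2n ⌊ y ℤ.<? x ⌋ + c) ≡⟨ sym (ℕ.+-assoc (b2n ⌊ x ℤ.<? a ⌋) _ c) ⟩
    (b2n ⌊ x ℤ.<? a ⌋ + b2n ⌊ y ℤ.<? x ⌋) + c ≡⟨ cong (_+ c) (extremal-descents ext) ⟩
    suc c                                     ≡⟨ sym (bit+not-bit d) ⟩
    (b2n d + c) + b2n (not d)                 ∎
    where
    open ≡-Reasoning
    bit+not-bit : ∀ d → (b2n d + c) + b2n (not d) ≡ suc c
    bit+not-bit true = ℕ.+-identityʳ (suc c)
    bit+not-bit false = ℕ.+-comm c 1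
  rest : map (countDesc ∘ (a ∷_)) (map (y ∷_) (insertions x w))
       ≡ map (λ b → (b2n d + c) + b2n b) (descent-increments x y w)
  rest = trans (sym (map-∘ (insertions x w)))
    (map-+-increments (b2n d) c (countDesc ∘ (y ∷_)) _ _ (countDesc-insertions x y w (extremal-tail ext)))

b2n-not-not : ∀ b → b2n (not (not b)) ≡ b2n b
b2n-not-not b = cong b2n (not-involutive b)

non-increments-above : ∀ x a w → All (ℤ._< x) (a ∷ w) →
  count not (descent-increments x a w) ≡ suc (countDesc (a ∷ w))
non-increments-above x a [] (a<x ∷ _) with x ℤ.<? a
... | yes x<a = ⊥-elim (ℤ.<-asym a<x x<a)
... | no _ = refl
non-increments-above x a (y ∷ w) (_ ∷ l<x) =
  trans (cong₂ _+_ (b2n-not-not ⌊ y ℤ.<? a ⌋) (non-increments-above x y w l<x)) (ℕ.+-suc _ _)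

non-increments-below : ∀ x a w → All (x ℤ.<_) (a ∷ w) → count not (descent-increments x a w) ≡ countDesc (a ∷ w)
non-increments-below x a [] (x<a ∷ _) with x ℤ.<? a
... | yes _ = refl
... | no ¬x<a = ⊥-elim (¬x<a x<a)
non-increments-below x a (y ∷ w) (_ ∷ x<l) =
  cong₂ _+_ (b2n-not-not ⌊ y ℤ.<? a ⌋) (non-increments-below x y w x<l)

desB-extensions-↭ : ∀ {n w} → IsWindow n w → map desB (extensions n w) ↭ profile n (desB w)
desB-extensions-↭ {n} {w} win = subst (_↭ profile n (desB w)) (sym statistics)
  (increments-↭-profile n (desB w) (bits⁺ ++ bits⁻) non-increments length≡′)
  where
  open IsWindow win
  above : All (ℤ._< + suc n) (+ 0 ∷ w)
  above = +<+ (s≤s z≤n) ∷ All.map letter-< letters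
  below : All (-[1+ n ] ℤ.<_) (+ 0 ∷ w)
  below = -<+ ∷ All.map letter-> letters
  bits⁺ = descent-increments (+ suc n) (+ 0) w
  bits⁻ = descent-increments -[1+ n ] (+ 0) w
  statistics : map desB (extensions n w) ≡ map (λ b → desB w + b2n b) (bits⁺ ++ bits⁻)
  statistics = trans (map-++ desB (insertions (+ suc n) w) _)
    (trans (cong₂ _++_ (countDesc-insertions _ (+ 0) w (inj₁ above)) (countDesc-insertions _ (+ 0) w (inj₂ below)))
           (sym (map-++ _ bits⁺ bits⁻)))
  non-increments : count not (bits⁺ ++ bits⁻) ≡ suc (desB w + desB w)
  non-increments = trans (count-++ not bits⁺ bits⁻)
    (cong₂ _+_ (non-increments-above _ (+ 0) w above) (non-increments-below _ (+ 0) w below))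
  length≡′ : length (bits⁺ ++ bits⁻) ≡ suc n + suc n
  length≡′ = trans (length-++ bits⁺)
    (cong₂ _+_ (trans (length-descent-increments _ _ w) (cong suc length≡))
               (trans (length-descent-increments _ _ w) (cong suc length≡)))

-- basc counts the pairs a ≪ b in the framed word 1̄ w 1.
framedLL : ℕ → ℤ → List ℤ → ℕ
framedLL n a w = countLL n (a ∷ w ++ + 1 ∷ [])

last : ℤ → List ℤ → ℤ
last y [] = y
last y (z ∷ w) = last z w

countLL-snoc : ∀ n y w z → countLL n (y ∷ w ++ z ∷ []) ≡ countLL n (y ∷ w) + b2n (ll n (last y w) z)
countLL-snoc n y [] z = ℕ.+-identityʳ _
countLL-snoc n y (y′ ∷ w) z =
  trans (cong (_+_ (b2n (ll n y y′))) (countLL-snoc n y′ w z)) (sym (ℕ.+-assoc (b2n (ll n y y′)) _ _))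

bascEnd-last : ∀ y w → bascEnd (y ∷ w) ≡ b2n ⌊ last y w ℤ.≤? -[1+ 1 ] ⌋
bascEnd-last y [] = refl
bascEnd-last y (y′ ∷ w) = bascEnd-last y′ w

basc≡framedLL : ∀ {n} → 1 ≤ n → ∀ w → basc n w ≡ framedLL n -[1+ 0 ] w
basc≡framedLL {n} 1≤n [] = cong (λ b → b2n b + 0) (sym (ll-start-end n))
basc≡framedLL {n} 1≤n (y ∷ w) = begin
  b2n ⌊ + 2 ℤ.≤? y ⌋ + countLL n (y ∷ w) + bascEnd (y ∷ w)
    ≡⟨ cong₂ (λ s e → b2n s + countLL n (y ∷ w) + e) (sym (ll-start 1≤n y))
             (trans (bascEnd-last y w) (cong b2n (sym (ll-end 1≤n (last y w))))) ⟩
  b2n (ll n -[1+ 0 ] y) + countLL n (y ∷ w) + b2n (ll n (last y w) (+ 1))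
    ≡⟨ ℕ.+-assoc (b2n (ll n -[1+ 0 ] y)) _ _ ⟩
  b2n (ll n -[1+ 0 ] y) + (countLL n (y ∷ w) + b2n (ll n (last y w) (+ 1)))
    ≡⟨ cong (_+_ (b2n (ll n -[1+ 0 ] y))) (sym (countLL-snoc n y w (+ 1))) ⟩
  framedLL n -[1+ 0 ] (y ∷ w) ∎
  where open ≡-Reasoning

framedLL-weaken : ∀ n a w → Letter n (+ 1) → All (Letter n) (a ∷ w) → framedLL (suc n) a w ≡ framedLL n a w
framedLL-weaken n a [] l1 (la ∷ _) = cong (_+ 0) (cong b2n (ll-weaken n la l1))
framedLL-weaken n a (y ∷ w) l1 (la ∷ lw) =
  cong₂ _+_ (cong b2n (ll-weaken n la (All.head lw))) (framedLL-weaken n y w l1 lw)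

ascent-increments : (ℤ → ℤ → Bool) → ℤ → List ℤ → List Bool
ascent-increments g a [] = g a (+ 1) ∷ []
ascent-increments g a (y ∷ w) = g a y ∷ ascent-increments g y w

length-ascent-increments : ∀ g a w → length (ascent-increments g a w) ≡ suc (length w)
length-ascent-increments g a [] = refl
length-ascent-increments g a (y ∷ w) = cong suc (length-ascent-increments g y w)

-- Inserting x between neighbours a, y replaces the term [a ≪ y] of framedLL by
-- [a ≪ x] + [x ≪ y] = [a ≪ y] + [g a y].
module _ (n : ℕ) (x : ℤ) (g : ℤ → ℤ → Bool)
  (local : ∀ {a y} → Letter n a → Letter n y →
    b2n (ll (suc n) a x) + b2n (ll (suc n) x y) ≡ b2n (ll n a y) + b2n (g a y))
  (l1 : Letter n (+ 1)) where

  framedLL-insertions : ∀ a w → All (Letter n) (a ∷ w) →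
    map (framedLL (suc n) a) (insertions x w) ≡ map (λ b → framedLL n a w + b2n b) (ascent-increments g a w)
  framedLL-insertions a [] (la ∷ _) = cong (_∷ []) (begin
    b2n (ll (suc n) a x) + (b2n (ll (suc n) x (+ 1)) + 0) ≡⟨ cong (_+_ (b2n (ll (suc n) a x))) (ℕ.+-identityʳ _) ⟩
    b2n (ll (suc n) a x) + b2n (ll (suc n) x (+ 1))       ≡⟨ local la l1 ⟩
    b2n (ll n a (+ 1)) + b2n (g a (+ 1))                   ≡⟨ cong (_+ b2n (g a (+ 1))) (sym (ℕ.+-identityʳ _)) ⟩
    (b2n (ll n a (+ 1)) + 0) + b2n (g a (+ 1))             ∎)
    where open ≡-Reasoning
  framedLL-insertions a (y ∷ w) (la ∷ lw) = cong₂ _∷_ first rest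
    where
    ly = All.head lw
    e = b2n (ll n a y)
    c = framedLL n y w
    first : b2n (ll (suc n) a x) + (b2n (ll (suc n) x y) + framedLL (suc n) y w) ≡ (e + c) + b2n (g a y)
    first = begin
      b2n (ll (suc n) a x) + (b2n (ll (suc n) x y) + framedLL (suc n) y w)
        ≡⟨ sym (ℕ.+-assoc (b2n (ll (suc n) a x)) _ _) ⟩
      (b2n (ll (suc n) a x) + b2n (ll (suc n) x y)) + framedLL (suc n) y w
        ≡⟨ cong₂ _+_ (local la ly) (framedLL-weaken n y w l1 lw) ⟩
      (e + b2n (g a y)) + c
        ≡⟨ xy∙z≈xz∙y e _ c ⟩
      (e + c) + b2n (g a y) ∎
      where open ≡-Reasoning
    rest : map (framedLL (suc n) a) (map (y ∷_) (insertions x w)) ≡ map (λ b → (e + c) + b2n b) (ascent-increments g y w)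
    rest = trans (sym (map-∘ (insertions x w)))
      (trans (map-cong (λ u → cong (λ t → b2n t + framedLL (suc n) y u) (ll-weaken n la ly)) (insertions x w))
             (map-+-increments e c (framedLL (suc n) y) _ _ (framedLL-insertions y w lw)))

-- Put n+1 between a and y: a ≪ n+1 unless a = n, while n+1 ≪ y never holds; dually for -(n+1).
top-increment : ℕ → ℤ → ℤ → Bool
top-increment n a y = not (ll n a y ∨ ⌊ a ℤ.≟ + n ⌋)

bottom-increment : ℕ → ℤ → ℤ → Bool
bottom-increment m a y = not (ll (suc m) a y ∨ ⌊ y ℤ.≟ -[1+ m ] ⌋)

top-local : ∀ {m a y} → Letter (suc m) a → Letter (suc m) y →
  b2n (ll (suc (suc m)) a (+ suc (suc m))) + b2n (ll (suc (suc m)) (+ suc (suc m)) y)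
    ≡ b2n (ll (suc m) a y) + b2n (top-increment (suc m) a y)
top-local {m} {a} {y} la _ rewrite ll-to-top la | ll-from-top (suc m) y with a ℤ.≟ + suc m
... | yes refl rewrite ll-from-top m y = refl
... | no _ with ll (suc m) a y
...   | true = refl
...   | false = refl

bottom-local : ∀ {m a y} → Letter (suc m) a → Letter (suc m) y →
  b2n (ll (suc (suc m)) a -[1+ suc m ]) + b2n (ll (suc (suc m)) -[1+ suc m ] y)
    ≡ b2n (ll (suc m) a y) + b2n (bottom-increment m a y)
bottom-local {m} {a} {y} _ ly rewrite ll-to-bottom (suc m) a | ll-from-bottom ly with y ℤ.≟ -[1+ m ]
... | yes refl rewrite ll-to-bottom m a = refl
... | no _ with ll (suc m) a y
...   | true = refl
...   | false = refl

top-non-increment : ∀ m a y → b2n (not (top-increment (suc m) a y)) ≡ b2n (ll (suc m) a y) + b2n ⌊ a ℤ.≟ + suc m ⌋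
top-non-increment m a y with a ℤ.≟ + suc m
... | yes refl rewrite ll-from-top m y = refl
... | no _ with ll (suc m) a y
...   | true = refl
...   | false = refl

bottom-non-increment : ∀ m a y → b2n (not (bottom-increment m a y)) ≡ b2n (ll (suc m) a y) + b2n ⌊ y ℤ.≟ -[1+ m ] ⌋
bottom-non-increment m a y with y ℤ.≟ -[1+ m ]
... | yes refl rewrite ll-to-bottom m a = refl
... | no _ with ll (suc m) a y
...   | true = refl
...   | false = refl

non-increments-top : ∀ m a w →
  count not (ascent-increments (top-increment (suc m)) a w)
    ≡ framedLL (suc m) a w + count (λ z → ⌊ z ℤ.≟ + suc m ⌋) (a ∷ w)
non-increments-top m a [] = trans (ℕ.+-identityʳ _) (trans (top-non-increment m a (+ 1))
  (cong₂ _+_ (sym (ℕ.+-identityʳ (b2n (ll (suc m) a (+ 1))))) (sym (ℕ.+-identityʳ (b2n ⌊ a ℤ.≟ + suc m ⌋)))))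
non-increments-top m a (y ∷ w) = trans (cong₂ _+_ (top-non-increment m a y) (non-increments-top m y w))
  (interchange (b2n (ll (suc m) a y)) (b2n ⌊ a ℤ.≟ + suc m ⌋) _ _)

non-increments-bottom : ∀ m a w →
  count not (ascent-increments (bottom-increment m) a w) ≡ framedLL (suc m) a w + count (λ z → ⌊ z ℤ.≟ -[1+ m ] ⌋) w
non-increments-bottom m a [] = trans (ℕ.+-identityʳ _) (trans (bottom-non-increment m a (+ 1))
  (cong (_+ _) (sym (ℕ.+-identityʳ (b2n (ll (suc m) a (+ 1)))))))
non-increments-bottom m a (y ∷ w) = trans (cong₂ _+_ (bottom-non-increment m a y) (non-increments-bottom m y w))
  (interchange (b2n (ll (suc m) a y)) (b2n ⌊ y ℤ.≟ -[1+ m ] ⌋) _ _)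

count-top+bottom : ∀ {m w} → IsWindow (suc m) w →
  count (λ z → ⌊ z ℤ.≟ + suc m ⌋) w + count (λ z → ⌊ z ℤ.≟ -[1+ m ] ⌋) w ≡ 1
count-top+bottom {m} {w} win =
  trans (count-+ _ _ (λ z → ⌊ absℕ z ℕ.≟ suc m ⌋) w pointwise)
    (trans (sym (count-map (λ i → ⌊ i ℕ.≟ suc m ⌋) absℕ w))
      (count-unique-≡ (map absℕ w) (window-abs-unique win) (IsWindow.covers win (ℕ.n<1+n m))))
  where
  pointwise : ∀ z → b2n ⌊ z ℤ.≟ + suc m ⌋ + b2n ⌊ z ℤ.≟ -[1+ m ] ⌋ ≡ b2n ⌊ absℕ z ℕ.≟ suc m ⌋
  pointwise (+ k) with + k ℤ.≟ + suc m | k ℕ.≟ suc m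
  ... | yes _ | yes _ = refl
  ... | no _ | no _ = refl
  ... | yes e | no k≢ = ⊥-elim (k≢ (ℤ.+-injective e))
  ... | no ≢ | yes refl = ⊥-elim (≢ refl)
  pointwise -[1+ k ] with -[1+ k ] ℤ.≟ -[1+ m ] | suc k ℕ.≟ suc m
  ... | yes _ | yes _ = refl
  ... | no _ | no _ = refl
  ... | yes refl | no ≢ = ⊥-elim (≢ refl)
  ... | no ≢ | yes refl = ⊥-elim (≢ refl)

basc-extensions-↭ : ∀ {m w} → IsWindow (suc m) w →
  map (basc (suc (suc m))) (extensions (suc m) w) ↭ profile (suc m) (basc (suc m) w)
basc-extensions-↭ {m} {w} win = subst (λ s → map (basc (suc (suc m))) (extensions (suc m) w) ↭ profile (suc m) s)
  (sym (basc≡framedLL (s≤s z≤n) w))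
  (subst (_↭ profile (suc m) s) (sym statistics)
    (increments-↭-profile (suc m) s (bits⁺ ++ bits⁻) non-increments length≡′))
  where
  open IsWindow win
  l1 : Letter (suc m) (+ 1)
  l1 = pos (s≤s z≤n)
  framed-letters : All (Letter (suc m)) (-[1+ 0 ] ∷ w)
  framed-letters = neg (s≤s z≤n) ∷ letters
  s = framedLL (suc m) -[1+ 0 ] w
  bits⁺ = ascent-increments (top-increment (suc m)) -[1+ 0 ] w
  bits⁻ = ascent-increments (bottom-increment m) -[1+ 0 ] w
  statistics : map (basc (suc (suc m))) (extensions (suc m) w) ≡ map (λ b → s + b2n b) (bits⁺ ++ bits⁻)
  statistics = begin
    map (basc (suc (suc m))) (extensions (suc m) w)
      ≡⟨ map-cong (basc≡framedLL (s≤s z≤n)) (extensions (suc m) w) ⟩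
    map (framedLL (suc (suc m)) -[1+ 0 ]) (extensions (suc m) w)
      ≡⟨ map-++ _ (insertions (+ suc (suc m)) w) _ ⟩
    map (framedLL (suc (suc m)) -[1+ 0 ]) (insertions (+ suc (suc m)) w)
      ++ map (framedLL (suc (suc m)) -[1+ 0 ]) (insertions -[1+ suc m ] w)
      ≡⟨ cong₂ _++_ (framedLL-insertions (suc m) _ _ top-local l1 -[1+ 0 ] w framed-letters)
                    (framedLL-insertions (suc m) _ _ bottom-local l1 -[1+ 0 ] w framed-letters) ⟩
    map (λ b → s + b2n b) bits⁺ ++ map (λ b → s + b2n b) bits⁻
      ≡⟨ sym (map-++ _ bits⁺ bits⁻) ⟩
    map (λ b → s + b2n b) (bits⁺ ++ bits⁻) ∎
    where open ≡-Reasoning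
  non-increments : count not (bits⁺ ++ bits⁻) ≡ suc (s + s)
  non-increments = begin
    count not (bits⁺ ++ bits⁻)
      ≡⟨ count-++ not bits⁺ bits⁻ ⟩
    count not bits⁺ + count not bits⁻
      ≡⟨ cong₂ _+_ (non-increments-top m -[1+ 0 ] w) (non-increments-bottom m -[1+ 0 ] w) ⟩
    (s + count (λ z → ⌊ z ℤ.≟ + suc m ⌋) w) + (s + count (λ z → ⌊ z ℤ.≟ -[1+ m ] ⌋) w)
      ≡⟨ interchange s _ s _ ⟩
    (s + s) + (count (λ z → ⌊ z ℤ.≟ + suc m ⌋) w + count (λ z → ⌊ z ℤ.≟ -[1+ m ] ⌋) w)
      ≡⟨ cong (_+_ (s + s)) (count-top+bottom win) ⟩
    (s + s) + 1
      ≡⟨ ℕ.+-comm (s + s) 1 ⟩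
    suc (s + s) ∎
    where open ≡-Reasoning
  length≡′ : length (bits⁺ ++ bits⁻) ≡ suc (suc m) + suc (suc m)
  length≡′ = trans (length-++ bits⁺)
    (cong₂ _+_ (trans (length-ascent-increments _ _ w) (cong suc length≡))
               (trans (length-ascent-increments _ _ w) (cong suc length≡)))

-- Equidistribution of basc and desB on Xₙ

extensions-step : ∀ m (st st′ : List ℤ → ℕ) →
  (∀ {w} → IsWindow (suc m) w → map st′ (extensions (suc m) w) ↭ profile (suc m) (st w)) →
  map st′ (X (suc (suc m))) ↭ concatMap (profile (suc m)) (map st (X (suc m)))
extensions-step m st st′ step = begin
  map st′ (X (suc (suc m)))
    ↭⟨ ↭.map⁺ st′ (X-suc-↭ m) ⟩
  map st′ (concatMap (extensions (suc m)) (X (suc m)))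
    ≡⟨ map-concatMap st′ (extensions (suc m)) (X (suc m)) ⟩
  concatMap (map st′ ∘ extensions (suc m)) (X (suc m))
    ↭⟨ concatMap-cong-↭ _ _ (X (suc m)) (λ w∈ → step (∈B⁻ (∈X⇒∈B {suc m} w∈))) ⟩
  concatMap (profile (suc m) ∘ st) (X (suc m))
    ≡⟨ concatMap-map (profile (suc m)) st (X (suc m)) ⟨
  concatMap (profile (suc m)) (map st (X (suc m))) ∎
  where open ↭.PermutationReasoning

basc-↭-desB : ∀ m → map (basc (suc m)) (X (suc m)) ↭ map desB (X (suc m))
basc-↭-desB zero = ↭.refl
basc-↭-desB (suc m) = begin
  map (basc (suc (suc m))) (X (suc (suc m)))
    ↭⟨ extensions-step m (basc (suc m)) (basc (suc (suc m))) basc-extensions-↭ ⟩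
  concatMap (profile (suc m)) (map (basc (suc m)) (X (suc m)))
    ↭⟨ concatMap⁺ (profile (suc m)) (basc-↭-desB m) ⟩
  concatMap (profile (suc m)) (map desB (X (suc m)))
    ↭⟨ extensions-step m desB desB desB-extensions-↭ ⟨
  map desB (X (suc (suc m))) ∎
  where open ↭.PermutationReasoning

-- Imported this late because with _-_ in scope the section -_ used above is ambiguous.
open import Data.Integer using (_-_)

coeffΨ-desB : ∀ n → 1 ≤ n → ∀ k → coeffΨ n k ≡ count (λ w → inX w ∧ ⌊ + desB w ℤ.≟ k ⌋) (B n)
coeffΨ-desB (suc m) _ k = begin
  coeffΨ (suc m) k
    ≡⟨ countᵇ≡count _ (B (suc m)) ⟩
  count (λ w → inX w ∧ is-k (basc (suc m) w)) (B (suc m))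
    ≡⟨ count-filterᵇ (is-k ∘ basc (suc m)) inX (B (suc m)) ⟨
  count (is-k ∘ basc (suc m)) (X (suc m))
    ≡⟨ count-map is-k (basc (suc m)) (X (suc m)) ⟨
  count is-k (map (basc (suc m)) (X (suc m)))
    ≡⟨ count-↭ is-k (basc-↭-desB m) ⟩
  count is-k (map desB (X (suc m)))
    ≡⟨ count-map is-k desB (X (suc m)) ⟩
  count (is-k ∘ desB) (X (suc m))
    ≡⟨ count-filterᵇ (is-k ∘ desB) inX (B (suc m)) ⟩
  count (λ w → inX w ∧ is-k (desB w)) (B (suc m)) ∎
  where
  open ≡-Reasoning
  is-k : ℕ → Bool
  is-k s = ⌊ + s ℤ.≟ k ⌋

≟-complement : ∀ a b n k → a + b ≡ n → ⌊ + b ℤ.≟ k ⌋ ≡ ⌊ + a ℤ.≟ + n - k ⌋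
≟-complement a b n k a+b≡n =
  T-ext (λ t → fromWitness (⇒ (toWitness t))) (λ t → fromWitness (⇐ (toWitness t)))
  where
  open ≡-Reasoning
  n≡a+b : + n ≡ + a ℤ.+ + b
  n≡a+b = trans (cong +_ (sym a+b≡n)) (ℤ.pos-+ a b)
  [x+y]-y≡x : ∀ x y → (x ℤ.+ y) - y ≡ x
  [x+y]-y≡x = solve-∀
  [x+y]-x≡y : ∀ x y → (x ℤ.+ y) - x ≡ y
  [x+y]-x≡y = solve-∀
  x-[x-y]≡y : ∀ x y → x - (x - y) ≡ y
  x-[x-y]≡y = solve-∀
  ⇒ : + b ≡ k → + a ≡ + n - k
  ⇒ refl = sym (trans (cong (_- + b) n≡a+b) ([x+y]-y≡x (+ a) (+ b)))
  ⇐ : + a ≡ + n - k → + b ≡ k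
  ⇐ e = begin
    + b                 ≡⟨ [x+y]-x≡y (+ a) (+ b) ⟨
    (+ a ℤ.+ + b) - + a ≡⟨ cong₂ _-_ n≡a+b (sym e) ⟨
    + n - (+ n - k)     ≡⟨ x-[x-y]≡y (+ n) k ⟩
    k                   ∎

-- The involution w ↦ -w exchanges Xₙ with its complement and desB with n - desB.
desB-outside-X : ∀ n → 1 ≤ n → ∀ k →
  count (λ w → not (inX w) ∧ ⌊ + desB w ℤ.≟ k ⌋) (B n)
    ≡ count (λ w → inX w ∧ ⌊ + desB w ℤ.≟ + n - k ⌋) (B n)
desB-outside-X n 1≤n k = trans (count-B-negate n _) (count-cong _ _ (B n) λ {w} w∈ →
  let win = ∈B⁻ {n} w∈ in
  cong₂ _∧_ (trans (cong not (inX-negate 1≤n win)) (not-involutive _))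
            (≟-complement (desB w) (desB (negate w)) n k (trans (ℕ.+-comm (desB w) _) (desB-negate win))))

corollary8p2 : (n : ℕ) → 1 ≤ n → (k : ℤ) →
    coeffΨ n k + coeffΨ n (+ n - k) ≡ coeffE n k
corollary8p2 n 1≤n k = begin
  coeffΨ n k + coeffΨ n (+ n - k)
    ≡⟨ cong₂ _+_ (coeffΨ-desB n 1≤n k) (coeffΨ-desB n 1≤n (+ n - k)) ⟩
  count (λ w → inX w ∧ desB-is k w) (B n) + count (λ w → inX w ∧ desB-is (+ n - k) w) (B n)
    ≡⟨ cong (_+_ (count (λ w → inX w ∧ desB-is k w) (B n))) (desB-outside-X n 1≤n k) ⟨
  count (λ w → inX w ∧ desB-is k w) (B n) + count (λ w → not (inX w) ∧ desB-is k w) (B n)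
    ≡⟨ count-split (desB-is k) inX (B n) ⟨
  count (desB-is k) (B n)
    ≡⟨ countᵇ≡count _ (B n) ⟨
  coeffE n k ∎
  where
  open ≡-Reasoning
  desB-is : ℤ → List ℤ → Bool
  desB-is k w = ⌊ + desB w ℤ.≟ k ⌋
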